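{- Let $G=(V,E)$ be a graph and let $u,v\in V$ be distinct vertices with $uv\notin E$. Let $\hat G=(V,E\cup\{uv\})$. Then $\lambda(\hat G)>\lambda(G)$ if and only if there is some $(H,H')\in\Lambda(G)$ such that $u$ and $v$ are both unsaturated in $H$, or $u$ and $v$ are both unsaturated in $H'$.
   Context: All graphs are finite, simple, undirected and loopless. $\lambda(G)=\max\{|H|+|H'| : H,H' \text{ are disjoint matchings in } G\}$ and $\Lambda(G)$ is the set of ordered pairs $(H,H')$ of disjoint matchings of $G$ with $|H|+|H'|=\lambda(G)$. A vertex $w$ is saturated in a matching $M$ if some edge of $M$ is incident to $w$, and unsaturated otherwise. -}

module Defs where

open import Data.Nat using (ℕ; _+_; _≤_)
open import Data.Bool using (Bool; true; false; _∧_; _∨_; if_then_else_)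
open import Data.Fin using (Fin; toℕ; _≟_)
open import Data.Fin using () renaming (_<?_ to _<ᶠ?_)
open import Data.List using (List; map; allFin)
open import Data.Nat.ListAction using (sum)
open import Data.Product using (_×_; Σ; ∃)
open import Relation.Nullary.Decidable using (⌊_⌋)
open import Relation.Binary.PropositionalEquality using (_≡_)
open import Relation.Nullary using (¬_)

Graph : ℕ → Set
Graph n = Fin n → Fin n → Bool

IsSimple : ∀ {n} → Graph n → Set
IsSimple {n} G = (∀ i j → G i j ≡ G j i) × (∀ i → G i i ≡ false)

addEdge : ∀ {n} → Graph n → Fin n → Fin n → Graph n
addEdge G u v i j =
  G i j ∨ ((⌊ i ≟ u ⌋ ∧ ⌊ j ≟ v ⌋) ∨ (⌊ i ≟ v ⌋ ∧ ⌊ j ≟ u ⌋))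

-- An edge set, given (symmetrically) as a Bool-valued relation.
EdgeSet : ℕ → Set
EdgeSet n = Fin n → Fin n → Bool

IsMatching : ∀ {n} → Graph n → EdgeSet n → Set
IsMatching {n} G M =
  (∀ i j → M i j ≡ M j i) ×
  (∀ i j → M i j ≡ true → G i j ≡ true) ×
  (∀ i j k → M i j ≡ true → M i k ≡ true → j ≡ k)

-- number of edges of M (each unordered edge {i,j} counted once, via i < j)
size : ∀ {n} → EdgeSet n → ℕ
size {n} M =
  sum (map (λ i → sum (map (λ j → if ⌊ i <ᶠ? j ⌋ ∧ M i j then 1 else 0)
                             (allFin n)))
           (allFin n))

Disjoint : ∀ {n} → EdgeSet n → EdgeSet n → Set
Disjoint {n} H H' = ∀ i j → H i j ≡ true → H' i j ≡ false

DisjPair : ∀ {n} → Graph n → EdgeSet n → EdgeSet n → Set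
DisjPair G H H' = IsMatching G H × IsMatching G H' × Disjoint H H'

IsLambda : ∀ {n} → Graph n → ℕ → Set
IsLambda {n} G k =
  (Σ (EdgeSet n) λ H → Σ (EdgeSet n) λ H' → DisjPair G H H' × (size H + size H' ≡ k)) ×
  (∀ H H' → DisjPair G H H' → size H + size H' ≤ k)

InΛ : ∀ {n} → Graph n → EdgeSet n → EdgeSet n → Set
InΛ G H H' = DisjPair G H H' × IsLambda G (size H + size H')

Unsaturated : ∀ {n} → EdgeSet n → Fin n → Set
Unsaturated {n} M w = ∀ j → M w j ≡ false

module Submission where

-- The proof moves single edges between pairs of disjoint matchings of G and
-- of Ĝ = G + uv.
--   * Counting: inserting one unordered pair {a , b} (a ≢ b) into an edge
--     set raises its size by exactly one (sizes are double sums over Fin n).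
--   * Augmenting: if u, v are unsaturated in H, then (H + uv , H') is a
--     disjoint pair of Ĝ one edge larger, so λ(Ĝ) > λ(G).
--   * Reducing: if an optimal pair (Ĥ , Ĥ') of Ĝ has uv ∈ Ĥ, then
--     (Ĥ - uv , Ĥ') is a disjoint pair of G with u, v unsaturated in Ĥ - uv,
--     one edge smaller; if λ(Ĝ) > λ(G) this pair is optimal for G.
--     If uv lies in neither matching, (Ĥ , Ĥ') is already a pair of G, which
--     is impossible when λ(Ĝ) > λ(G).

open import Defs
open import Data.Nat using (ℕ; zero; suc; _+_; _≤_; _<_)
open import Data.Nat.Properties
  using (+-suc; +-comm; ≤-trans; ≤-pred; n<1+n; <⇒≱; module ≤-Reasoning)
open import Data.Fin using (Fin; _≟_) renaming (_<_ to _<ᶠ_; zero to fzero; suc to fsuc)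
open import Data.Fin.Properties using (<-asym; <-cmp; suc-injective) renaming (_<?_ to _<ᶠ?_)
open import Data.Bool using (Bool; true; false; _∧_; _∨_; not; if_then_else_)
open import Data.Bool.Properties
  using ( ∨-comm; ∨-zeroʳ; ∨-identityʳ; ∧-comm; ∧-identityʳ; ∧-zeroʳ
        ; ∧-conicalˡ; ∧-conicalʳ; ¬-not)
open import Data.Product using (_×_; Σ; _,_; proj₁; proj₂)
open import Data.Sum using (_⊎_; inj₁; inj₂; [_,_]′)
open import Data.List using (map; allFin; tabulate)
open import Data.List.Properties using (map-tabulate)
open import Data.Nat.ListAction using (sum)
open import Function using (_∘_; id)
open import Relation.Nullary using (¬_; Dec; yes; no; contradiction)
open import Relation.Nullary.Decidable using (⌊_⌋)
open import Relation.Binary using (tri<; tri≈; tri>)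
open import Relation.Binary.PropositionalEquality
  using (_≡_; _≢_; refl; sym; trans; cong; cong₂; subst; module ≡-Reasoning)
open import Function.Bundles using (_⇔_; mk⇔)

clash : ∀ {A : Set} {b : Bool} → b ≡ true → b ≡ false → A
clash refl ()

∨-true : ∀ {a b : Bool} → a ∨ b ≡ true → a ≡ true ⊎ b ≡ true
∨-true {true} _ = inj₁ refl
∨-true {false} e = inj₂ e

∨-introˡ : ∀ {a b : Bool} → a ≡ true → a ∨ b ≡ true
∨-introˡ refl = refl

∨-introʳ : ∀ a {b : Bool} → b ≡ true → a ∨ b ≡ true
∨-introʳ a refl = ∨-zeroʳ a

witness : ∀ {A : Set} (a? : Dec A) → ⌊ a? ⌋ ≡ true → A
witness (yes a) _ = a
witness (no _) ()

decided : ∀ {A : Set} (a? : Dec A) → A → ⌊ a? ⌋ ≡ true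
decided (yes _) _ = refl
decided (no ¬a) a = contradiction a ¬a

∑ : ∀ n → (Fin n → ℕ) → ℕ
∑ zero f = 0
∑ (suc n) f = f fzero + ∑ n (f ∘ fsuc)

sum-allFin : ∀ n (f : Fin n → ℕ) → sum (map f (allFin n)) ≡ ∑ n f
sum-allFin n f = trans (cong sum (map-tabulate id f)) (sum-tabulate n f)
  where
  sum-tabulate : ∀ n (f : Fin n → ℕ) → sum (tabulate f) ≡ ∑ n f
  sum-tabulate zero f = refl
  sum-tabulate (suc n) f = cong (f _ +_) (sum-tabulate n (f ∘ _))

∑-cong : ∀ n {f g : Fin n → ℕ} → (∀ x → f x ≡ g x) → ∑ n f ≡ ∑ n g
∑-cong zero e = refl
∑-cong (suc n) e = cong₂ _+_ (e _) (∑-cong n (e ∘ _))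

∑-increment : ∀ n {f g : Fin n → ℕ} (a : Fin n) →
  (∀ x → x ≢ a → g x ≡ f x) → g a ≡ suc (f a) → ∑ n g ≡ suc (∑ n f)
∑-increment (suc n) fzero off at =
  cong₂ _+_ at (∑-cong n (λ x → off (fsuc x) (λ ())))
∑-increment (suc n) {f} (fsuc a) off at =
  trans (cong₂ _+_ (off fzero (λ ()))
                   (∑-increment n a (λ x x≢a → off (fsuc x) (x≢a ∘ suc-injective)) at))
        (+-suc (f fzero) _)

counted : ∀ {n} → EdgeSet n → Fin n → Fin n → ℕ
counted M i j = if ⌊ i <ᶠ? j ⌋ ∧ M i j then 1 else 0

size-∑ : ∀ {n} (M : EdgeSet n) → size M ≡ ∑ n (λ i → ∑ n (counted M i))
size-∑ {n} M = trans (sum-allFin n _) (∑-cong n (λ i → sum-allFin n (counted M i)))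

AgreeOff : ∀ {n} → Fin n → Fin n → EdgeSet n → EdgeSet n → Set
AgreeOff a b M M' = ∀ i j → ¬ (i ≡ a × j ≡ b) → ¬ (i ≡ b × j ≡ a) → M i j ≡ M' i j

size-insert< : ∀ {n} {M M' : EdgeSet n} {a b : Fin n} → a <ᶠ b → AgreeOff a b M M' →
  M a b ≡ false → M' a b ≡ true → size M' ≡ suc (size M)
size-insert< {n} {M} {M'} {a} {b} a<b agree Mab M'ab = begin
  size M'                                  ≡⟨ size-∑ M' ⟩
  ∑ n (λ i → ∑ n (counted M' i))           ≡⟨ ∑-increment n a off-row row-a ⟩
  suc (∑ n (λ i → ∑ n (counted M i)))      ≡⟨ cong suc (sym (size-∑ M)) ⟩
  suc (size M)                             ∎
  where
  open ≡-Reasoning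
  same : ∀ i j → ¬ (i ≡ a × j ≡ b) → counted M' i j ≡ counted M i j
  same i j ≢ab with i <ᶠ? j
  ... | no _ = refl
  ... | yes i<j = cong (λ x → if x then 1 else 0)
                    (sym (agree i j ≢ab (λ { (refl , refl) → <-asym a<b i<j })))
  off-row : ∀ i → i ≢ a → ∑ n (counted M' i) ≡ ∑ n (counted M i)
  off-row i i≢a = ∑-cong n (λ j → same i j (i≢a ∘ proj₁))
  at-ab : counted M' a b ≡ suc (counted M a b)
  at-ab with a <ᶠ? b
  ... | no a≮b = contradiction a<b a≮b
  ... | yes _ rewrite Mab | M'ab = refl
  row-a : ∑ n (counted M' a) ≡ suc (∑ n (counted M a))
  row-a = ∑-increment n b (λ j j≢b → same a j (j≢b ∘ proj₂)) at-ab

size-insert : ∀ {n} {M M' : EdgeSet n} {a b : Fin n} → a ≢ b → AgreeOff a b M M' →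
  M a b ≡ false → M b a ≡ false → M' a b ≡ true → M' b a ≡ true →
  size M' ≡ suc (size M)
size-insert {a = a} {b} a≢b agree Mab Mba M'ab M'ba with <-cmp a b
... | tri< a<b _ _ = size-insert< a<b agree Mab M'ab
... | tri≈ _ a≡b _ = contradiction a≡b a≢b
... | tri> _ _ b<a = size-insert< b<a (λ i j p q → agree i j q p) Mba M'ba

-- The edge uv as an edge set, i.e. the ordered pairs (u , v) and (v , u);
-- by definition addEdge M u v i j is M i j ∨ pairUV u v i j.
pairUV : ∀ {n} → Fin n → Fin n → EdgeSet n
pairUV u v i j = (⌊ i ≟ u ⌋ ∧ ⌊ j ≟ v ⌋) ∨ (⌊ i ≟ v ⌋ ∧ ⌊ j ≟ u ⌋)

removeEdge : ∀ {n} → EdgeSet n → Fin n → Fin n → EdgeSet n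
removeEdge M u v i j = M i j ∧ not (pairUV u v i j)

_⊆_ : ∀ {n} → EdgeSet n → EdgeSet n → Set
M ⊆ N = ∀ i j → M i j ≡ true → N i j ≡ true

module _ {n} {u v : Fin n} where

  pairUV-cases : ∀ i j → pairUV u v i j ≡ true → (i ≡ u × j ≡ v) ⊎ (i ≡ v × j ≡ u)
  pairUV-cases i j e with ∨-true e
  ... | inj₁ e₁ = inj₁ ( witness (i ≟ u) (∧-conicalˡ _ _ e₁)
                       , witness (j ≟ v) (∧-conicalʳ _ _ e₁))
  ... | inj₂ e₂ = inj₂ ( witness (i ≟ v) (∧-conicalˡ _ _ e₂)
                       , witness (j ≟ u) (∧-conicalʳ _ _ e₂))

  pairUV-off : ∀ {i j} → ¬ (i ≡ u × j ≡ v) → ¬ (i ≡ v × j ≡ u) → pairUV u v i j ≡ false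
  pairUV-off ≢uv ≢vu = ¬-not (λ e → [ ≢uv , ≢vu ]′ (pairUV-cases _ _ e))

  pairUV-sym : ∀ i j → pairUV u v i j ≡ pairUV u v j i
  pairUV-sym i j = begin
    (⌊ i ≟ u ⌋ ∧ ⌊ j ≟ v ⌋) ∨ (⌊ i ≟ v ⌋ ∧ ⌊ j ≟ u ⌋)
      ≡⟨ cong₂ _∨_ (∧-comm ⌊ i ≟ u ⌋ _) (∧-comm ⌊ i ≟ v ⌋ _) ⟩
    (⌊ j ≟ v ⌋ ∧ ⌊ i ≟ u ⌋) ∨ (⌊ j ≟ u ⌋ ∧ ⌊ i ≟ v ⌋)
      ≡⟨ ∨-comm (⌊ j ≟ v ⌋ ∧ _) _ ⟩
    (⌊ j ≟ u ⌋ ∧ ⌊ i ≟ v ⌋) ∨ (⌊ j ≟ v ⌋ ∧ ⌊ i ≟ u ⌋)  ∎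
    where open ≡-Reasoning

  pairUV-uv : pairUV u v u v ≡ true
  pairUV-uv = ∨-introˡ (cong₂ _∧_ (decided (u ≟ u) refl) (decided (v ≟ v) refl))

  pairUV-vu : pairUV u v v u ≡ true
  pairUV-vu = trans (pairUV-sym v u) pairUV-uv

  addEdge-agree : (M : EdgeSet n) → AgreeOff u v M (addEdge M u v)
  addEdge-agree M i j ≢uv ≢vu =
    sym (trans (cong (M i j ∨_) (pairUV-off ≢uv ≢vu)) (∨-identityʳ _))

  removeEdge-agree : (M : EdgeSet n) → AgreeOff u v (removeEdge M u v) M
  removeEdge-agree M i j ≢uv ≢vu =
    trans (cong (λ b → M i j ∧ not b) (pairUV-off ≢uv ≢vu)) (∧-identityʳ _)

  weaken : ∀ {G M} → IsMatching G M → IsMatching (addEdge G u v) M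
  weaken (sym-M , M⊆G , uniq) = sym-M , (λ i j → ∨-introˡ ∘ M⊆G i j) , uniq

  restrict : ∀ {G M} → IsMatching (addEdge G u v) M → M u v ≡ false → IsMatching G M
  restrict {G} {M} (sym-M , M⊆Ĝ , uniq) Muv = sym-M , M⊆G , uniq
    where
    M⊆G : M ⊆ G
    M⊆G i j e with ∨-true {G i j} (M⊆Ĝ i j e)
    ... | inj₁ g = g
    ... | inj₂ p with pairUV-cases i j p
    ...   | inj₁ (refl , refl) = clash e Muv
    ...   | inj₂ (refl , refl) = clash e (trans (sym-M v u) Muv)

  extend : ∀ {G M} → u ≢ v → IsMatching G M → Unsaturated M u → Unsaturated M v →
    IsMatching (addEdge G u v) (addEdge M u v)
  extend {G} {M} u≢v (sym-M , M⊆G , uniq) unsat-u unsat-v =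
    (λ i j → cong₂ _∨_ (sym-M i j) (pairUV-sym i j)) , M+⊆Ĝ , uniq+
    where
    M+⊆Ĝ : addEdge M u v ⊆ addEdge G u v
    M+⊆Ĝ i j e = [ ∨-introˡ ∘ M⊆G i j , ∨-introʳ (G i j) ]′ (∨-true {M i j} e)
    unsat : ∀ {w j} → w ≡ u ⊎ w ≡ v → M w j ≡ false
    unsat (inj₁ refl) = unsat-u _
    unsat (inj₂ refl) = unsat-v _
    endpoint : ∀ i j → pairUV u v i j ≡ true → i ≡ u ⊎ i ≡ v
    endpoint i j p = [ inj₁ ∘ proj₁ , inj₂ ∘ proj₁ ]′ (pairUV-cases i j p)
    uniq-pair : ∀ i j k → pairUV u v i j ≡ true → pairUV u v i k ≡ true → j ≡ k
    uniq-pair i j k p q with pairUV-cases i j p | pairUV-cases i k q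
    ... | inj₁ (_ , j≡v) | inj₁ (_ , k≡v) = trans j≡v (sym k≡v)
    ... | inj₂ (_ , j≡u) | inj₂ (_ , k≡u) = trans j≡u (sym k≡u)
    ... | inj₁ (i≡u , _) | inj₂ (i≡v , _) = contradiction (trans (sym i≡u) i≡v) u≢v
    ... | inj₂ (i≡v , _) | inj₁ (i≡u , _) = contradiction (trans (sym i≡u) i≡v) u≢v
    uniq+ : ∀ i j k → addEdge M u v i j ≡ true → addEdge M u v i k ≡ true → j ≡ k
    uniq+ i j k e₁ e₂ with ∨-true {M i j} e₁ | ∨-true {M i k} e₂
    ... | inj₁ m₁ | inj₁ m₂ = uniq i j k m₁ m₂
    ... | inj₂ p  | inj₂ q  = uniq-pair i j k p q
    ... | inj₁ m₁ | inj₂ q  = clash m₁ (unsat (endpoint i k q))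
    ... | inj₂ p  | inj₁ m₂ = clash m₂ (unsat (endpoint i j p))

  shrink : ∀ {G M} → IsMatching (addEdge G u v) M → IsMatching G (removeEdge M u v)
  shrink {G} {M} (sym-M , M⊆Ĝ , uniq) = sym⁻ , M⁻⊆G , uniq⁻
    where
    sym⁻ : ∀ i j → removeEdge M u v i j ≡ removeEdge M u v j i
    sym⁻ i j = cong₂ (λ a b → a ∧ not b) (sym-M i j) (pairUV-sym i j)
    M⁻⊆G : removeEdge M u v ⊆ G
    M⁻⊆G i j e with ∨-true {G i j} (M⊆Ĝ i j (∧-conicalˡ _ _ e))
    ... | inj₁ g = g
    ... | inj₂ p = clash (∧-conicalʳ (M i j) _ e) (cong not p)
    uniq⁻ : ∀ i j k → removeEdge M u v i j ≡ true → removeEdge M u v i k ≡ true → j ≡ k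
    uniq⁻ i j k e₁ e₂ = uniq i j k (∧-conicalˡ _ _ e₁) (∧-conicalˡ _ _ e₂)

  -- If ww' ∈ M is the pair uv, then w is unsaturated in M - uv: its only edge was ww'.
  removeEdge-unsat : ∀ {G M w w'} → IsMatching G M → M w w' ≡ true →
    pairUV u v w w' ≡ true → Unsaturated (removeEdge M u v) w
  removeEdge-unsat {M = M} {w} (_ , _ , uniq) Mww' p j with M w j in e
  ... | false = refl
  ... | true with uniq w j _ e Mww'
  ...   | refl = cong not p

  size-addEdge : ∀ {M} → u ≢ v → M u v ≡ false → M v u ≡ false →
    size (addEdge M u v) ≡ suc (size M)
  size-addEdge {M} u≢v Muv Mvu =
    size-insert u≢v (addEdge-agree M) Muv Mvu
      (∨-introʳ (M u v) pairUV-uv) (∨-introʳ (M v u) pairUV-vu)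

  size-removeEdge : ∀ {M} → u ≢ v → M u v ≡ true → M v u ≡ true →
    size M ≡ suc (size (removeEdge M u v))
  size-removeEdge {M} u≢v Muv Mvu =
    size-insert u≢v (removeEdge-agree M) (removed pairUV-uv) (removed pairUV-vu) Muv Mvu
    where
    removed : ∀ {i j} → pairUV u v i j ≡ true → removeEdge M u v i j ≡ false
    removed {i} {j} p rewrite p = ∧-zeroʳ (M i j)

disjoint-swap : ∀ {n} {H H' : EdgeSet n} → Disjoint H H' → Disjoint H' H
disjoint-swap {H = H} disj i j h' with H i j in e
... | false = refl
... | true = clash h' (disj i j e)

pair-swap : ∀ {n} {G : Graph n} {H H' : EdgeSet n} → DisjPair G H H' → DisjPair G H' H
pair-swap (m , m' , disj) = m' , m , disjoint-swap disj

module _ {n} {G : Graph n} {u v : Fin n} where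

  private
    Ĝ : Graph n
    Ĝ = addEdge G u v

  augment : ∀ {H H'} → u ≢ v → G u v ≡ false → DisjPair G H H' →
    Unsaturated H u → Unsaturated H v → DisjPair Ĝ (addEdge H u v) H'
  augment {H} {H'} u≢v Guv (m , m'@(sym-H' , H'⊆G , _) , disj) unsat-u unsat-v =
    extend u≢v m unsat-u unsat-v , weaken m' , disj⁺
    where
    H'uv : H' u v ≡ false
    H'uv = ¬-not (λ e → clash (H'⊆G u v e) Guv)
    disj⁺ : Disjoint (addEdge H u v) H'
    disj⁺ i j e with ∨-true {H i j} e
    ... | inj₁ h = disj i j h
    ... | inj₂ p with pairUV-cases i j p
    ...   | inj₁ (refl , refl) = H'uv
    ...   | inj₂ (refl , refl) = trans (sym-H' v u) H'uv

  reduce : ∀ {H H'} → DisjPair Ĝ H H' → H u v ≡ true → DisjPair G (removeEdge H u v) H'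
  reduce (m , m' , disj) Huv =
    shrink m , restrict m' (disj u v Huv) , (λ i j → disj i j ∘ ∧-conicalˡ _ _)

  lift : ∀ {H H'} → DisjPair Ĝ H H' → H u v ≡ false → H' u v ≡ false → DisjPair G H H'
  lift (m , m' , disj) Huv H'uv = restrict m Huv , restrict m' H'uv , disj

optimal : ∀ {n} {G : Graph n} {H H' : EdgeSet n} {k : ℕ} → IsLambda G k →
  DisjPair G H H' → k ≤ size H + size H' → InΛ G H H'
optimal (_ , bound) pair k≤ =
  pair , ((_ , _ , pair , refl) , λ K K' p → ≤-trans (bound K K' p) k≤)

isLambda-≤ : ∀ {n} {G : Graph n} {k m : ℕ} → IsLambda G k → IsLambda G m → k ≤ m
isLambda-≤ ((K , K' , pair , refl) , _) (_ , bound) = bound K K' pair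

inΛ-swap : ∀ {n} {G : Graph n} {H H' : EdgeSet n} → InΛ G H H' → InΛ G H' H
inΛ-swap {H = H} {H'} (pair , opt) =
  pair-swap pair , subst (IsLambda _) (+-comm (size H) (size H')) opt

ExtendableAt : ∀ {n} → Graph n → Fin n → Fin n → Set
ExtendableAt {n} G u v =
  Σ (EdgeSet n) λ H → Σ (EdgeSet n) λ H' → InΛ G H H' ×
    ((Unsaturated H u × Unsaturated H v) ⊎ (Unsaturated H' u × Unsaturated H' v))

module _ {n} {G : Graph n} {u v : Fin n} (u≢v : u ≢ v) where

  gain : ∀ {H H' k k̂} → G u v ≡ false → IsLambda G k → IsLambda (addEdge G u v) k̂ →
    InΛ G H H' → Unsaturated H u → Unsaturated H v → k < k̂
  gain {H} {H'} {k} {k̂} Guv λG (_ , bound̂) (pair , opt) unsat-u unsat-v = begin-strict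
    k                              ≤⟨ isLambda-≤ λG opt ⟩
    size H + size H'               <⟨ n<1+n _ ⟩
    suc (size H + size H')         ≡⟨ cong (_+ size H') (sym grows) ⟩
    size (addEdge H u v) + size H' ≤⟨ bound̂ _ _ (augment u≢v Guv pair unsat-u unsat-v) ⟩
    k̂                              ∎
    where
    open ≤-Reasoning
    grows : size (addEdge H u v) ≡ suc (size H)
    grows = size-addEdge u≢v (unsat-u v) (unsat-v u)

  drop : ∀ {H H' k} → IsLambda G k → k < size H + size H' →
    DisjPair (addEdge G u v) H H' → H u v ≡ true →
    InΛ G (removeEdge H u v) H' ×
      (Unsaturated (removeEdge H u v) u × Unsaturated (removeEdge H u v) v)
  drop {H} {H'} {k} λG k< pair@(m@(sym-H , _) , _) Huv =
    optimal λG (reduce pair Huv) (≤-pred (subst (suc k ≤_) shrinks k<)) ,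
    removeEdge-unsat m Huv (pairUV-uv {u = u}) ,
    removeEdge-unsat m Hvu (pairUV-vu {v = v})
    where
    Hvu : H v u ≡ true
    Hvu = trans (sym-H v u) Huv
    shrinks : size H + size H' ≡ suc (size (removeEdge H u v) + size H')
    shrinks = cong (_+ size H') (size-removeEdge u≢v Huv Hvu)

  -- The "if" direction; the case of H' reduces to that of H by swapping.
  extendable⇒gap : ∀ {k k̂} → G u v ≡ false → IsLambda G k → IsLambda (addEdge G u v) k̂ →
    ExtendableAt G u v → k < k̂
  extendable⇒gap Guv λG λĜ (_ , _ , inΛ , inj₁ (unsat-u , unsat-v)) =
    gain Guv λG λĜ inΛ unsat-u unsat-v
  extendable⇒gap Guv λG λĜ (_ , _ , inΛ , inj₂ (unsat-u , unsat-v)) =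
    gain Guv λG λĜ (inΛ-swap inΛ) unsat-u unsat-v

  -- The "only if" direction: an optimal pair (Ĥ , Ĥ') of G + uv must use uv
  -- when λ(G + uv) > λ(G), and dropping it exhibits the required pair of G.
  gap⇒extendable : ∀ {k k̂} → IsLambda G k → IsLambda (addEdge G u v) k̂ →
    k < k̂ → ExtendableAt G u v
  gap⇒extendable {k} λG@(_ , bound) ((Ĥ , Ĥ' , pair̂ , refl) , _) k<k̂
    with Ĥ u v in Ĥuv | Ĥ' u v in Ĥ'uv
  ... | true | _ =
    let (inΛ , unsat) = drop λG k<k̂ pair̂ Ĥuv in _ , _ , inΛ , inj₁ unsat
  ... | false | true =
    let k<k̂' = subst (k <_) (+-comm (size Ĥ) _) k<k̂
        (inΛ , unsat) = drop λG k<k̂' (pair-swap pair̂) Ĥ'uv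
    in _ , _ , inΛ-swap inΛ , inj₂ unsat
  ... | false | false = contradiction (bound Ĥ Ĥ' (lift pair̂ Ĥuv Ĥ'uv)) (<⇒≱ k<k̂)

lemma3p1 : ∀ {n} (G : Graph n) → IsSimple G →
    (u v : Fin n) → u ≢ v → G u v ≡ false →
    (k k̂ : ℕ) → IsLambda G k → IsLambda (addEdge G u v) k̂ →
    (k < k̂ ⇔
      Σ (EdgeSet n) λ H → Σ (EdgeSet n) λ H' → InΛ G H H' ×
        ((Unsaturated H u × Unsaturated H v) ⊎ (Unsaturated H' u × Unsaturated H' v)))
lemma3p1 G _ u v u≢v Guv k k̂ λG λĜ =
  mk⇔ (gap⇒extendable u≢v λG λĜ) (extendable⇒gap u≢v Guv λG λĜ)
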